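{- For a positive integer $n$, let $M(n)$ be the largest size of a set of permutations of $[n]=\{1,\dots,n\}$ such that any two distinct permutations in the set are locally disjoint. Then $$\frac{n!}{5^n}\le M(n)\le \frac{n!}{6^{\lfloor n/3\rfloor}}.$$
   Context: A permutation of $[n]$ is a bijection $[n]\to[n]$; for a permutation $\sigma$ and $a\in[n]$, $\sigma^{ -1}(a)$ is the position of $a$ when $\sigma$ is viewed as the linear order $\sigma(1),\dots,\sigma(n)$. Two permutations $\sigma,\tau$ of $[n]$ are called locally disjoint if there exist two distinct elements $a,b\in[n]$ such that $\sigma^{ -1}(a)<\sigma^{ -1}(b)<\tau^{ -1}(a)<\tau^{ -1}(b)$ or $\tau^{ -1}(a)<\tau^{ -1}(b)<\sigma^{ -1}(a)<\sigma^{ -1}(b)$. -}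

module Defs where

open import Data.Nat using (ℕ; _≤_)
open import Data.Fin using (Fin; _<_)
open import Data.Fin.Permutation using (Permutation′; _⟨$⟩ˡ_)
open import Data.List using (List; length)
open import Data.List.Relation.Unary.AllPairs using (AllPairs)
open import Data.Product using (_×_; ∃₂; Σ)
open import Data.Sum using (_⊎_)
open import Relation.Binary.PropositionalEquality using (_≢_; _≡_)

-- position of the element a in the linear order σ(1),…,σ(n), i.e. σ⁻¹(a)
pos : ∀ {n} → Permutation′ n → Fin n → Fin n
pos σ a = σ ⟨$⟩ˡ a

LocallyDisjoint : ∀ {n} → Permutation′ n → Permutation′ n → Set
LocallyDisjoint {n} σ τ =
  ∃₂ λ (a b : Fin n) → a ≢ b ×
    ((pos σ a < pos σ b × pos σ b < pos τ a × pos τ a < pos τ b)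
     ⊎ (pos τ a < pos τ b × pos τ b < pos σ a × pos σ a < pos σ b))

-- Locally disjoint permutations are distinct, so such a list has no
-- repetitions and its length is the size of the corresponding set.
PairwiseLD : ∀ {n} → List (Permutation′ n) → Set
PairwiseLD = AllPairs LocallyDisjoint

IsM : ℕ → ℕ → Set
IsM n m =
  (Σ (List (Permutation′ n)) λ S → PairwiseLD S × length S ≡ m)
  × (∀ (S : List (Permutation′ n)) → PairwiseLD S → length S ≤ m)

-- Upper bound: shuffling the positions inside each block {3k, 3k+1, 3k+2} keeps every entry in its
-- block, and two permutations placing every entry in the same block are never locally disjoint,
-- since positions p < q < r < s with p, r and q, s in common blocks of size three do not exist.
-- So the 6^⌊n/3⌋ shuffles of the members of a pairwise locally disjoint family are all distinct.
--
-- Lower bound: in a maximal family S every permutation τ fails to be locally disjoint from some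
-- σ ∈ S. Drawing the arcs k ⟶ π k of the permutation π that sends positions in σ to positions in τ,
-- this says that neither π nor π⁻¹ has crossing rising arcs i < j < π i < π j, and such a π is determined
-- by the directions of the arcs leaving and entering each k, which take only five values.
-- So τ ↦ (σ, arc code) is injective and n! ≤ |S| · 5ⁿ.
--
-- The maximum M(n) exists since pairwise locally disjoint lists of a given length can be searched
-- through ranks of permutations, and their length is at most n!.

module Submission where

open import Defs
open import Data.Nat using (ℕ; _≤_; _*_; _^_; _/_; _!)
open import Data.Product using (Σ; _×_)

open import Data.Nat as ℕ using (zero; suc; _+_; z≤n; s≤s)
open import Data.Nat.Properties as ℕ using (1+n≰n; m≤m*n; m^n≢0)
open import Data.Nat.DivMod using (m/n≡1+[m∸n]/n; m<n⇒m/n≡0; /-monoˡ-≤)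
open import Data.Fin as Fin
  using (Fin; suc; toℕ; _<_; _↑ˡ_; _↑ʳ_; punchOut; combine; remQuot; quotient; remainder; funToFin; finToFun)
open import Data.Fin.Properties
  using (<-cmp; <-irrefl; <⇒≢; _≟_; any?; toℕ<n; toℕ-↑ˡ; ↑ˡ-injective; ↑ʳ-injective;
         splitAt-↑ˡ; splitAt-↑ʳ; +↔⊎; punchOut-cong; combine-remQuot; remQuot-combine; combine-injective;
         finToFun-funToFin; injective⇒≤)
open import Data.Fin.Induction using (<-wellFounded)
open import Data.Fin.Patterns using (0F; 1F; 2F; 3F; 4F)
open import Data.Fin.Permutation
  using (Permutation′; _⟨$⟩ʳ_; _⟨$⟩ˡ_; inverseˡ; inverseʳ; _≈_; _∘ₚ_; flip; id; insert; remove;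
         insert-remove; remove-insert)
open import Data.List using (List; []; _∷_; length; lookup; map)
open import Data.List.Properties using (length-map)
open import Data.List.Membership.Propositional.Properties using (∈-lookup)
open import Data.List.Relation.Unary.All as All using (All)
open import Data.List.Relation.Unary.All.Properties using (¬Any⇒All¬)
open import Data.List.Relation.Unary.Any as Any using (Any; index)
open import Data.List.Relation.Unary.Any.Properties using (lookup-result)
open import Data.List.Relation.Unary.AllPairs as AllPairs using (AllPairs; []; _∷_; allPairs?)
open import Data.List.Relation.Unary.AllPairs.Properties using (map⁺)
open import Data.Product using (_,_; proj₁; proj₂; ∃; uncurry)
open import Data.Sum using (inj₁; inj₂)
import Data.Sum as Sum
open import Data.Sum.Function.Propositional using (_⊎-↔_)
open import Data.Empty using (⊥; ⊥-elim)
open import Function using (_∘_)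
open import Function.Construct.Composition using (_↔-∘_)
open import Function.Construct.Symmetry using (↔-sym)
open import Induction.WellFounded using (Acc; acc)
open import Relation.Binary.Definitions using (Tri; tri<; tri≈; tri>)
open import Relation.Binary.PropositionalEquality
open import Relation.Nullary using (¬_; Dec; yes; no; contradiction)
open import Relation.Nullary.Decidable as Dec using (_×-dec_; _⊎-dec_; ¬?; decidable-stable)

private
  variable
    m n : ℕ

-- Permutations and their ranks

flip-cong : {σ τ : Permutation′ n} → σ ≈ τ → flip σ ≈ flip τ
flip-cong {σ = σ} {τ} σ≈τ a = begin
  σ ⟨$⟩ˡ a                   ≡⟨ cong (σ ⟨$⟩ˡ_) (inverseʳ τ) ⟨
  σ ⟨$⟩ˡ (τ ⟨$⟩ʳ (τ ⟨$⟩ˡ a))  ≡⟨ cong (σ ⟨$⟩ˡ_) (σ≈τ _) ⟨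
  σ ⟨$⟩ˡ (σ ⟨$⟩ʳ (τ ⟨$⟩ˡ a))  ≡⟨ inverseˡ σ ⟩
  τ ⟨$⟩ˡ a                   ∎
  where open ≡-Reasoning

∘ₚ-cancelʳ : (π π′ ρ : Permutation′ n) → π ∘ₚ ρ ≈ π′ ∘ₚ ρ → π ≈ π′
∘ₚ-cancelʳ π π′ ρ eq k = trans (sym (inverseˡ ρ)) (trans (cong (ρ ⟨$⟩ˡ_) (eq k)) (inverseˡ ρ))

∘ₚ-cancelˡ : (ρ π π′ : Permutation′ n) → ρ ∘ₚ π ≈ ρ ∘ₚ π′ → π ≈ π′
∘ₚ-cancelˡ ρ π π′ eq a = subst (λ x → π ⟨$⟩ʳ x ≡ π′ ⟨$⟩ʳ x) (inverseʳ ρ) (eq (ρ ⟨$⟩ˡ a))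

remQuot-injective : ∀ {m} k (x y : Fin (m * k)) → remQuot {m} k x ≡ remQuot {m} k y → x ≡ y
remQuot-injective {m} k x y eq =
  trans (sym (combine-remQuot {m} k x)) (trans (cong (uncurry combine) eq) (combine-remQuot {m} k y))

funToFin-injective : ∀ {k} (f g : Fin n → Fin k) → funToFin f ≡ funToFin g → ∀ i → f i ≡ g i
funToFin-injective f g eq i =
  trans (sym (finToFun-funToFin f i)) (trans (cong (λ x → finToFun x i) eq) (finToFun-funToFin g i))

punchOut-cong₂ : {i i′ j j′ : Fin (suc n)} (i≢j : i ≢ j) (i′≢j′ : i′ ≢ j′) →
                 i ≡ i′ → j ≡ j′ → punchOut i≢j ≡ punchOut i′≢j′
punchOut-cong₂ {i = i} _ _ refl refl = punchOut-cong i refl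

remove-cong : {σ τ : Permutation′ (suc n)} → σ ≈ τ → remove 0F σ ≈ remove 0F τ
remove-cong σ≈τ j = punchOut-cong₂ _ _ (σ≈τ 0F) (σ≈τ (suc j))

insert-cong : ∀ i j {π ρ : Permutation′ n} → π ≈ ρ → insert i j π ≈ insert i j ρ
insert-cong i j π≈ρ k with i ≟ k
... | yes _ = refl
... | no  _ = cong (Fin.punchIn j) (π≈ρ _)

insert-at : ∀ i j (π : Permutation′ n) → insert i j π ⟨$⟩ʳ i ≡ j
insert-at i j π with i ≟ i
... | yes _  = refl
... | no i≢i = contradiction refl i≢i

rank : Permutation′ n → Fin (n !)
rank {zero}  σ = 0F
rank {suc n} σ = combine (σ ⟨$⟩ʳ 0F) (rank (remove 0F σ))

unrank : Fin (n !) → Permutation′ n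
unrank {zero}  _ = id
unrank {suc n} x = insert 0F (quotient (n !) x) (unrank (remainder {suc n} (n !) x))

rank-cong : {σ τ : Permutation′ n} → σ ≈ τ → rank σ ≡ rank τ
rank-cong {zero}  _   = refl
rank-cong {suc n} {σ} {τ} σ≈τ = cong₂ combine (σ≈τ 0F) (rank-cong (remove-cong {σ = σ} {τ} σ≈τ))

rank-unrank : (x : Fin (n !)) → rank (unrank {n} x) ≡ x
rank-unrank {zero}  0F = refl
rank-unrank {suc n} x = begin
  combine (π ⟨$⟩ʳ 0F) (rank (remove 0F π))
    ≡⟨ cong₂ combine (insert-at 0F q ρ) (rank-cong (remove-insert 0F q ρ)) ⟩
  combine q (rank ρ)
    ≡⟨ cong (combine q) (rank-unrank {n} r) ⟩
  combine q r
    ≡⟨ combine-remQuot {suc n} (n !) x ⟩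
  x ∎
  where
  open ≡-Reasoning
  q : Fin (suc n)
  q = quotient (n !) x
  r : Fin (n !)
  r = remainder {suc n} (n !) x
  ρ : Permutation′ n
  ρ = unrank r
  π : Permutation′ (suc n)
  π = insert 0F q ρ

unrank-rank : (σ : Permutation′ n) → unrank {n} (rank σ) ≈ σ
unrank-rank {zero}  σ ()
unrank-rank {suc n} σ i = begin
  unrank {suc n} (rank σ) ⟨$⟩ʳ i
    ≡⟨ cong (λ (q , r) → insert 0F q (unrank {n} r) ⟨$⟩ʳ i)
            (remQuot-combine (σ ⟨$⟩ʳ 0F) (rank ρ)) ⟩
  insert 0F (σ ⟨$⟩ʳ 0F) (unrank {n} (rank ρ)) ⟨$⟩ʳ i
    ≡⟨ insert-cong 0F (σ ⟨$⟩ʳ 0F) (unrank-rank ρ) i ⟩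
  insert 0F (σ ⟨$⟩ʳ 0F) ρ ⟨$⟩ʳ i
    ≡⟨ insert-remove 0F σ i ⟩
  σ ⟨$⟩ʳ i ∎
  where
  open ≡-Reasoning
  ρ : Permutation′ n
  ρ = remove 0F σ

rank-injective : {σ τ : Permutation′ n} → rank σ ≡ rank τ → σ ≈ τ
rank-injective {n} {σ} {τ} eq i =
  trans (sym (unrank-rank σ i)) (trans (cong (λ x → unrank {n} x ⟨$⟩ʳ i) eq) (unrank-rank τ i))

unrank-injective : (x y : Fin (n !)) → unrank {n} x ≈ unrank {n} y → x ≡ y
unrank-injective {n} x y eq = trans (sym (rank-unrank {n} x)) (trans (rank-cong eq) (rank-unrank {n} y))

LD-sym : (σ τ : Permutation′ n) → LocallyDisjoint σ τ → LocallyDisjoint τ σ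
LD-sym σ τ (a , b , a≢b , inj₁ order) = a , b , a≢b , inj₂ order
LD-sym σ τ (a , b , a≢b , inj₂ order) = a , b , a≢b , inj₁ order

LD-resp-≈ : {σ σ′ τ τ′ : Permutation′ n} → σ ≈ σ′ → τ ≈ τ′ → LocallyDisjoint σ τ → LocallyDisjoint σ′ τ′
LD-resp-≈ {n} {σ} {σ′} {τ} {τ′} σ≈σ′ τ≈τ′ (a , b , a≢b , order) =
  a , b , a≢b , Sum.map (along σ σ′ τ τ′ s t) (along τ τ′ σ σ′ t s) order
  where
  s : flip σ ≈ flip σ′
  s = flip-cong {n} {σ} {σ′} σ≈σ′
  t : flip τ ≈ flip τ′
  t = flip-cong {n} {τ} {τ′} τ≈τ′
  along : (ρ ρ′ ϕ ϕ′ : Permutation′ n) → flip ρ ≈ flip ρ′ → flip ϕ ≈ flip ϕ′ →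
          pos ρ a < pos ρ b × pos ρ b < pos ϕ a × pos ϕ a < pos ϕ b →
          pos ρ′ a < pos ρ′ b × pos ρ′ b < pos ϕ′ a × pos ϕ′ a < pos ϕ′ b
  along _ _ _ _ r f (p , q , o) =
    subst₂ _<_ (r a) (r b) p , subst₂ _<_ (r b) (f a) q , subst₂ _<_ (f a) (f b) o

LD? : (σ τ : Permutation′ n) → Dec (LocallyDisjoint σ τ)
LD? σ τ = any? λ a → any? λ b →
  ¬? (a ≟ b) ×-dec
  ((pos σ a Fin.<? pos σ b ×-dec pos σ b Fin.<? pos τ a ×-dec pos τ a Fin.<? pos τ b)
   ⊎-dec (pos τ a Fin.<? pos τ b ×-dec pos τ b Fin.<? pos σ a ×-dec pos σ a Fin.<? pos σ b))

lookup-pairwise : {A : Set} {R : A → A → Set} {xs : List A} → AllPairs R xs →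
                  {i j : Fin (length xs)} → i < j → R (lookup xs i) (lookup xs j)
lookup-pairwise (Rx ∷ _)   {0F}  {suc j} _        = All.lookup Rx (∈-lookup j)
lookup-pairwise (_ ∷ Rxs) {suc i} {suc j} (s≤s i<j) = lookup-pairwise Rxs i<j

-- Upper bound: shuffling inside blocks of three positions

block : Fin n → ℕ
block p = toℕ p / 3

[3+m]/3≡1+m/3 : ∀ m → (3 + m) / 3 ≡ suc (m / 3)
[3+m]/3≡1+m/3 m = m/n≡1+[m∸n]/n {3 + m} (s≤s (s≤s (s≤s z≤n)))

blocks-not-interleaved : ∀ {x₁ x₂ x₃ x₄} → x₁ ℕ.< x₂ → x₂ ℕ.< x₃ → x₃ ℕ.< x₄ →
                         x₁ / 3 ≡ x₃ / 3 → x₂ / 3 ≡ x₄ / 3 → ⊥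
blocks-not-interleaved {x₁} {x₂} {x₃} {x₄} x₁<x₂ x₂<x₃ x₃<x₄ same₁₃ same₂₄ = ℕ.<-irrefl refl (begin-strict
  x₁ / 3        <⟨ ℕ.n<1+n (x₁ / 3) ⟩
  suc (x₁ / 3)  ≡⟨ [3+m]/3≡1+m/3 x₁ ⟨
  (3 + x₁) / 3  ≤⟨ /-monoˡ-≤ 3 (ℕ.≤-trans (s≤s (s≤s x₁<x₂)) (ℕ.≤-trans (s≤s x₂<x₃) x₃<x₄)) ⟩
  x₄ / 3        ≡⟨ same₂₄ ⟨
  x₂ / 3        ≤⟨ /-monoˡ-≤ 3 (ℕ.<⇒≤ x₂<x₃) ⟩
  x₃ / 3        ≡⟨ same₁₃ ⟨
  x₁ / 3        ∎)
  where open ℕ.≤-Reasoning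

same-blocks⇒¬LD : (σ τ : Permutation′ n) → (∀ a → block (pos σ a) ≡ block (pos τ a)) →
                  ¬ LocallyDisjoint σ τ
same-blocks⇒¬LD σ τ same (a , b , _ , inj₁ (p , q , r)) =
  blocks-not-interleaved p q r (same a) (same b)
same-blocks⇒¬LD σ τ same (a , b , _ , inj₂ (p , q , r)) =
  blocks-not-interleaved p q r (sym (same a)) (sym (same b))

_⊕_ : Permutation′ m → Permutation′ n → Permutation′ (m + n)
σ ⊕ τ = ↔-sym +↔⊎ ↔-∘ ((σ ⊎-↔ τ) ↔-∘ +↔⊎)

⊕-↑ˡ : (σ : Permutation′ m) (τ : Permutation′ n) (i : Fin m) → (σ ⊕ τ) ⟨$⟩ʳ (i ↑ˡ n) ≡ (σ ⟨$⟩ʳ i) ↑ˡ n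
⊕-↑ˡ {m} {n} σ τ i = cong (Fin.join m n ∘ Sum.map (σ ⟨$⟩ʳ_) (τ ⟨$⟩ʳ_)) (splitAt-↑ˡ m i n)

⊕-↑ʳ : (σ : Permutation′ m) (τ : Permutation′ n) (j : Fin n) → (σ ⊕ τ) ⟨$⟩ʳ (m ↑ʳ j) ≡ m ↑ʳ (τ ⟨$⟩ʳ j)
⊕-↑ʳ {m} {n} σ τ j = cong (Fin.join m n ∘ Sum.map (σ ⟨$⟩ʳ_) (τ ⟨$⟩ʳ_)) (splitAt-↑ʳ m n j)

⊕-injective : (σ σ′ : Permutation′ m) (τ τ′ : Permutation′ n) → σ ⊕ τ ≈ σ′ ⊕ τ′ → σ ≈ σ′ × τ ≈ τ′
⊕-injective {m} {n} σ σ′ τ τ′ eq =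
  (λ i → ↑ˡ-injective n _ _ (trans (sym (⊕-↑ˡ σ τ i)) (trans (eq (i ↑ˡ n)) (⊕-↑ˡ σ′ τ′ i)))) ,
  (λ j → ↑ʳ-injective m _ _ (trans (sym (⊕-↑ʳ σ τ j)) (trans (eq (m ↑ʳ j)) (⊕-↑ʳ σ′ τ′ j))))

block-↑ˡ : (i : Fin 3) → block (i ↑ˡ n) ≡ 0
block-↑ˡ {n} i = m<n⇒m/n≡0 (subst (ℕ._< 3) (sym (toℕ-↑ˡ i n)) (toℕ<n i))

⊕-preserves-block : (σ : Permutation′ 3) (τ : Permutation′ n) → (∀ q → block (τ ⟨$⟩ˡ q) ≡ block q) →
                    ∀ p → block ((σ ⊕ τ) ⟨$⟩ˡ p) ≡ block p
⊕-preserves-block {n} σ τ τ-preserves 0F                  = block-↑ˡ {n} (σ ⟨$⟩ˡ 0F)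
⊕-preserves-block {n} σ τ τ-preserves 1F                  = block-↑ˡ {n} (σ ⟨$⟩ˡ 1F)
⊕-preserves-block {n} σ τ τ-preserves 2F                  = block-↑ˡ {n} (σ ⟨$⟩ˡ 2F)
⊕-preserves-block {n} σ τ τ-preserves (suc (suc (suc q))) = begin
  (3 + toℕ (τ ⟨$⟩ˡ q)) / 3  ≡⟨ [3+m]/3≡1+m/3 (toℕ (τ ⟨$⟩ˡ q)) ⟩
  suc (block (τ ⟨$⟩ˡ q))    ≡⟨ cong suc (τ-preserves q) ⟩
  suc (block q)             ≡⟨ [3+m]/3≡1+m/3 (toℕ q) ⟨
  (3 + toℕ q) / 3           ∎
  where open ≡-Reasoning

blocks : ℕ → ℕ
blocks (suc (suc (suc n))) = suc (blocks n)
blocks _                   = 0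

blocks≡n/3 : ∀ n → blocks n ≡ n / 3
blocks≡n/3 0                   = refl
blocks≡n/3 1                   = refl
blocks≡n/3 2                   = refl
blocks≡n/3 (suc (suc (suc n))) = trans (cong suc (blocks≡n/3 n)) (sym ([3+m]/3≡1+m/3 n))

blockShuffle : ∀ n → Fin (6 ^ blocks n) → Permutation′ n
blockShuffle (suc (suc (suc n))) c =
  unrank {3} (quotient (6 ^ blocks n) c) ⊕ blockShuffle n (remainder {6} (6 ^ blocks n) c)
blockShuffle 0 _ = id
blockShuffle 1 _ = id
blockShuffle 2 _ = id

blockShuffle-injective : ∀ n (c d : Fin (6 ^ blocks n)) → blockShuffle n c ≈ blockShuffle n d → c ≡ d
blockShuffle-injective (suc (suc (suc n))) c d eq = remQuot-injective {6} (6 ^ blocks n) c d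
  (cong₂ _,_ (unrank-injective {3} _ _ (proj₁ parts)) (blockShuffle-injective n _ _ (proj₂ parts)))
  where
  σ : Fin (6 ^ blocks (3 + n)) → Permutation′ 3
  σ = unrank {3} ∘ quotient (6 ^ blocks n)
  τ : Fin (6 ^ blocks (3 + n)) → Permutation′ n
  τ = blockShuffle n ∘ remainder {6} (6 ^ blocks n)
  parts : σ c ≈ σ d × τ c ≈ τ d
  parts = ⊕-injective (σ c) (σ d) (τ c) (τ d) eq
blockShuffle-injective 0 0F 0F _ = refl
blockShuffle-injective 1 0F 0F _ = refl
blockShuffle-injective 2 0F 0F _ = refl

blockShuffle-preserves-block : ∀ n c (p : Fin n) → block (blockShuffle n c ⟨$⟩ˡ p) ≡ block p
blockShuffle-preserves-block (suc (suc (suc n))) c =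
  ⊕-preserves-block (unrank {3} (quotient (6 ^ blocks n) c)) (blockShuffle n (remainder {6} (6 ^ blocks n) c))
                    (blockShuffle-preserves-block n (remainder {6} (6 ^ blocks n) c))
blockShuffle-preserves-block 0 _ _ = refl
blockShuffle-preserves-block 1 _ _ = refl
blockShuffle-preserves-block 2 _ _ = refl

shuffles-not-LD : ∀ c d (σ τ : Permutation′ n) → blockShuffle n c ∘ₚ σ ≈ blockShuffle n d ∘ₚ τ →
                  ¬ LocallyDisjoint σ τ
shuffles-not-LD {n} c d σ τ eq = same-blocks⇒¬LD σ τ λ a → begin
  block (pos σ a)                        ≡⟨ blockShuffle-preserves-block n c (pos σ a) ⟨
  block ((blockShuffle n c ∘ₚ σ) ⟨$⟩ˡ a)  ≡⟨ cong block (flip-cong {σ = β c ∘ₚ σ} {β d ∘ₚ τ} eq a) ⟩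
  block ((blockShuffle n d ∘ₚ τ) ⟨$⟩ˡ a)  ≡⟨ blockShuffle-preserves-block n d (pos τ a) ⟩
  block (pos τ a)                        ∎
  where
  open ≡-Reasoning
  β : Fin (6 ^ blocks n) → Permutation′ n
  β = blockShuffle n

upper-bound : {S : List (Permutation′ n)} → PairwiseLD S → length S * 6 ^ blocks n ≤ n !
upper-bound {n} {S} ld = injective⇒≤ {f = rank ∘ uncurry shuffled ∘ remQuot K} λ {x} {y} eq →
  remQuot-injective K x y (uncurry (cong₂ _,_) (shuffled-injective (rank-injective eq)))
  where
  K : ℕ
  K = 6 ^ blocks n
  shuffled : Fin (length S) → Fin K → Permutation′ n
  shuffled i c = blockShuffle n c ∘ₚ lookup S i
  shuffled-injective : ∀ {i j c d} → shuffled i c ≈ shuffled j d → i ≡ j × c ≡ d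
  shuffled-injective {i} {j} {c} {d} eq with <-cmp i j
  ... | tri< i<j _ _ =
    contradiction (lookup-pairwise ld i<j) (shuffles-not-LD c d (lookup S i) (lookup S j) eq)
  ... | tri> _ _ j<i =
    contradiction (LD-sym (lookup S j) (lookup S i) (lookup-pairwise ld j<i))
                  (shuffles-not-LD c d (lookup S i) (lookup S j) eq)
  ... | tri≈ _ refl _ =
    refl , blockShuffle-injective n c d (∘ₚ-cancelʳ (blockShuffle n c) (blockShuffle n d) (lookup S i) eq)

-- Lower bound: arc diagrams

Noncrossing : Permutation′ n → Set
Noncrossing π = ∀ {i j} → i < j → j < π ⟨$⟩ʳ i → ¬ (π ⟨$⟩ʳ i < π ⟨$⟩ʳ j)

-- The position in τ of the entry at position k of σ.
relocate : Permutation′ n → Permutation′ n → Permutation′ n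
relocate σ τ = σ ∘ₚ flip τ

¬LD⇒noncrossing : (σ τ : Permutation′ n) → ¬ LocallyDisjoint σ τ → Noncrossing (relocate σ τ)
¬LD⇒noncrossing σ τ ¬ld {i} {j} i<j j<πi πi<πj = ¬ld (σ ⟨$⟩ʳ i , σ ⟨$⟩ʳ j , σi≢σj , inj₁
  (subst₂ _<_ (sym (inverseˡ σ)) (sym (inverseˡ σ)) i<j ,
   subst (_< pos τ (σ ⟨$⟩ʳ i)) (sym (inverseˡ σ)) j<πi ,
   πi<πj))
  where
  σi≢σj : σ ⟨$⟩ʳ i ≢ σ ⟨$⟩ʳ j
  σi≢σj eq = <⇒≢ i<j (trans (sym (inverseˡ σ)) (trans (cong (σ ⟨$⟩ˡ_) eq) (inverseˡ σ)))

module _ {π π′ : Permutation′ n} (nc : Noncrossing π) (nc′ : Noncrossing π′)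
         (closes : ∀ k → π ⟨$⟩ˡ k < k → π′ ⟨$⟩ˡ k < k)
         (opens : ∀ k → k < π′ ⟨$⟩ʳ k → k < π ⟨$⟩ʳ k) where

  -- Suppose c = π i < π′ i and let i′ ⟶ c be the π′-arc ending at c. It cannot start before i (it
  -- would cross i ⟶ π′ i), so it starts inside i ⟶ c; the π-arc from i′ then ends before c (or it
  -- crosses i ⟶ c) and overshoots again, with a smaller end point.
  no-overshoot : ∀ i → i < π ⟨$⟩ʳ i → ¬ (π ⟨$⟩ʳ i < π′ ⟨$⟩ʳ i)
  no-overshoot i = descend i (<-wellFounded (π ⟨$⟩ʳ i))
    where
    descend : ∀ i → Acc _<_ (π ⟨$⟩ʳ i) → i < π ⟨$⟩ʳ i → ¬ (π ⟨$⟩ʳ i < π′ ⟨$⟩ʳ i)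
    descend i (acc smaller) i<c c<c′ = compare-starts (<-cmp i′ i)
      where
      c : Fin n
      c = π ⟨$⟩ʳ i
      i′ : Fin n
      i′ = π′ ⟨$⟩ˡ c
      π′i′≡c : π′ ⟨$⟩ʳ i′ ≡ c
      π′i′≡c = inverseʳ π′
      i′<c : i′ < c
      i′<c = closes c (subst (_< c) (sym (inverseˡ π)) i<c)
      i′<πi′ : i′ < π ⟨$⟩ʳ i′
      i′<πi′ = opens i′ (subst (i′ <_) (sym π′i′≡c) i′<c)
      compare-ends : i < i′ → Tri (π ⟨$⟩ʳ i′ < c) (π ⟨$⟩ʳ i′ ≡ c) (c < π ⟨$⟩ʳ i′) → ⊥
      compare-ends _    (tri< πi′<c _ _) =
        descend i′ (smaller πi′<c) i′<πi′ (subst (π ⟨$⟩ʳ i′ <_) (sym π′i′≡c) πi′<c)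
      compare-ends i<i′ (tri≈ _ πi′≡c _) =
        <⇒≢ i<i′ (trans (sym (inverseˡ π)) (trans (cong (π ⟨$⟩ˡ_) (sym πi′≡c)) (inverseˡ π)))
      compare-ends i<i′ (tri> _ _ c<πi′) = nc i<i′ i′<c c<πi′
      compare-starts : Tri (i′ < i) (i′ ≡ i) (i < i′) → ⊥
      compare-starts (tri< i′<i _ _) =
        nc′ i′<i (subst (i <_) (sym π′i′≡c) i<c) (subst (_< π′ ⟨$⟩ʳ i) (sym π′i′≡c) c<c′)
      compare-starts (tri≈ _ i′≡i _) = <-irrefl (trans (sym π′i′≡c) (cong (π′ ⟨$⟩ʳ_) i′≡i)) c<c′
      compare-starts (tri> _ _ i<i′) = compare-ends i<i′ (<-cmp (π ⟨$⟩ʳ i′) c)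

data Dir : Set where
  up fixed down : Dir

Towards : Dir → Fin n → Fin n → Set
Towards up    k l = k < l
Towards fixed k l = k ≡ l
Towards down  k l = l < k

dir : Fin n → Fin n → Dir
dir k l with <-cmp k l
... | tri< _ _ _ = up
... | tri≈ _ _ _ = fixed
... | tri> _ _ _ = down

dir-sound : (k l : Fin n) → Towards (dir k l) k l
dir-sound k l with <-cmp k l
... | tri< k<l _ _ = k<l
... | tri≈ _ k≡l _ = k≡l
... | tri> _ _ l<k = l<k

dir-complete : ∀ d {k l : Fin n} → Towards d k l → dir k l ≡ d
dir-complete up {k} {l} k<l with <-cmp k l
... | tri< _ _ _   = refl
... | tri≈ ¬k<l _ _ = contradiction k<l ¬k<l
... | tri> ¬k<l _ _ = contradiction k<l ¬k<l
dir-complete fixed {k} {l} k≡l with <-cmp k l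
... | tri< _ k≢l _ = contradiction k≡l k≢l
... | tri≈ _ _ _   = refl
... | tri> _ k≢l _ = contradiction k≡l k≢l
dir-complete down {k} {l} l<k with <-cmp k l
... | tri< _ _ ¬l<k = contradiction l<k ¬l<k
... | tri≈ _ _ ¬l<k = contradiction l<k ¬l<k
... | tri> _ _ _    = refl

dir-transfer : ∀ d {k l l′ : Fin n} → dir k l ≡ dir k l′ → Towards d k l → Towards d k l′
dir-transfer d {k} {l} {l′} same towards =
  subst (λ e → Towards e k l′) (trans (sym same) (dir-complete d towards)) (dir-sound k l′)

module _ {π π′ : Permutation′ n} (nc : Noncrossing π) (nc′ : Noncrossing π′)
         (sameʳ : ∀ k → dir k (π ⟨$⟩ʳ k) ≡ dir k (π′ ⟨$⟩ʳ k))
         (sameˡ : ∀ k → dir k (π ⟨$⟩ˡ k) ≡ dir k (π′ ⟨$⟩ˡ k)) where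

  rising-arcs-agree : ∀ k → k < π ⟨$⟩ʳ k → π ⟨$⟩ʳ k ≡ π′ ⟨$⟩ʳ k
  rising-arcs-agree k k<πk with <-cmp (π ⟨$⟩ʳ k) (π′ ⟨$⟩ʳ k)
  ... | tri≈ _ πk≡π′k _ = πk≡π′k
  ... | tri< πk<π′k _ _ = contradiction πk<π′k
    (no-overshoot {π = π} {π′} nc nc′ (λ k → dir-transfer down (sameˡ k)) (λ k → dir-transfer up (sym (sameʳ k)))
                  k k<πk)
  ... | tri> _ _ π′k<πk = contradiction π′k<πk
    (no-overshoot {π = π′} {π} nc′ nc (λ k → dir-transfer down (sym (sameˡ k)))
                  (λ k → dir-transfer up (sameʳ k))
                  k (dir-transfer up (sameʳ k) k<πk))

-- Falling arcs of π are the rising arcs of its inverse.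
arcs-determine : {π π′ : Permutation′ n} →
                 Noncrossing π → Noncrossing (flip π) → Noncrossing π′ → Noncrossing (flip π′) →
                 (∀ k → dir k (π ⟨$⟩ʳ k) ≡ dir k (π′ ⟨$⟩ʳ k)) →
                 (∀ k → dir k (π ⟨$⟩ˡ k) ≡ dir k (π′ ⟨$⟩ˡ k)) → π ≈ π′
arcs-determine {π = π} {π′} nc ncˡ nc′ nc′ˡ sameʳ sameˡ k with <-cmp k (π ⟨$⟩ʳ k)
... | tri< k<πk _ _ = rising-arcs-agree {π = π} {π′} nc nc′ sameʳ sameˡ k k<πk
... | tri≈ _ k≡πk _ = trans (sym k≡πk) (dir-transfer fixed (sameʳ k) k≡πk)
... | tri> _ _ πk<k = sym (begin
  π′ ⟨$⟩ʳ k                          ≡⟨ cong (π′ ⟨$⟩ʳ_) (trans (sym (inverseˡ π)) inverses-agree) ⟩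
  π′ ⟨$⟩ʳ (π′ ⟨$⟩ˡ (π ⟨$⟩ʳ k))        ≡⟨ inverseʳ π′ ⟩
  π ⟨$⟩ʳ k                           ∎)
  where
  open ≡-Reasoning
  inverses-agree : π ⟨$⟩ˡ (π ⟨$⟩ʳ k) ≡ π′ ⟨$⟩ˡ (π ⟨$⟩ʳ k)
  inverses-agree = rising-arcs-agree {π = flip π} {flip π′} ncˡ nc′ˡ sameˡ sameʳ (π ⟨$⟩ʳ k)
                                     (subst (π ⟨$⟩ʳ k <_) (sym (inverseˡ π)) πk<k)

-- The five possible pairs (direction of the arc leaving k, direction of the arc entering k):
-- one of them is fixed exactly when the other is.
pack : Dir → Dir → Fin 5
pack fixed _    = 0F
pack up    up   = 1F
pack up    _    = 2F
pack down  up   = 3F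
pack down  _    = 4F

unpack : Fin 5 → Dir × Dir
unpack 0F                                   = fixed , fixed
unpack (1F)                         = up , up
unpack (2F)               = up , down
unpack (3F)     = down , up
unpack (suc (suc (suc (suc _)))) = down , down

unpack-pack : ∀ d e → (d ≡ fixed → e ≡ fixed) → (e ≡ fixed → d ≡ fixed) → unpack (pack d e) ≡ (d , e)
unpack-pack fixed fixed _ _ = refl
unpack-pack fixed up    f _ = contradiction (f refl) λ ()
unpack-pack fixed down  f _ = contradiction (f refl) λ ()
unpack-pack up    fixed _ g = contradiction (g refl) λ ()
unpack-pack down  fixed _ g = contradiction (g refl) λ ()
unpack-pack up    up    _ _ = refl
unpack-pack up    down  _ _ = refl
unpack-pack down  up    _ _ = refl
unpack-pack down  down  _ _ = refl

arcCode : Permutation′ n → Fin n → Fin 5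
arcCode π k = pack (dir k (π ⟨$⟩ʳ k)) (dir k (π ⟨$⟩ˡ k))

fixed⇒fixed⁻¹ : (π : Permutation′ n) (k : Fin n) → dir k (π ⟨$⟩ʳ k) ≡ fixed → dir k (π ⟨$⟩ˡ k) ≡ fixed
fixed⇒fixed⁻¹ π k fixes = dir-complete fixed (begin
  k                  ≡⟨ inverseˡ π ⟨
  π ⟨$⟩ˡ (π ⟨$⟩ʳ k)   ≡⟨ cong (π ⟨$⟩ˡ_) k≡πk ⟨
  π ⟨$⟩ˡ k           ∎)
  where
  open ≡-Reasoning
  k≡πk : k ≡ π ⟨$⟩ʳ k
  k≡πk = subst (λ d → Towards d k (π ⟨$⟩ʳ k)) fixes (dir-sound k (π ⟨$⟩ʳ k))

unpack-arcCode : (π : Permutation′ n) (k : Fin n) →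
                 unpack (arcCode π k) ≡ (dir k (π ⟨$⟩ʳ k) , dir k (π ⟨$⟩ˡ k))
unpack-arcCode π k = unpack-pack _ _ (fixed⇒fixed⁻¹ π k) (fixed⇒fixed⁻¹ (flip π) k)

arcCode-determines : {π π′ : Permutation′ n} →
                     Noncrossing π → Noncrossing (flip π) → Noncrossing π′ → Noncrossing (flip π′) →
                     (∀ k → arcCode π k ≡ arcCode π′ k) → π ≈ π′
arcCode-determines {π = π} {π′} nc ncˡ nc′ nc′ˡ same =
  arcs-determine {π = π} {π′} nc ncˡ nc′ nc′ˡ (cong proj₁ ∘ dirs) (cong proj₂ ∘ dirs)
  where
  dirs : ∀ k → (dir k (π ⟨$⟩ʳ k) , dir k (π ⟨$⟩ˡ k)) ≡ (dir k (π′ ⟨$⟩ʳ k) , dir k (π′ ⟨$⟩ˡ k))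
  dirs k = trans (sym (unpack-arcCode π k)) (trans (cong unpack (same k)) (unpack-arcCode π′ k))

¬LD-determined : (σ τ τ′ : Permutation′ n) → ¬ LocallyDisjoint σ τ → ¬ LocallyDisjoint σ τ′ →
                 funToFin (arcCode (relocate σ τ)) ≡ funToFin (arcCode (relocate σ τ′)) → τ ≈ τ′
¬LD-determined σ τ τ′ ¬ld ¬ld′ same = flip-cong {σ = flip τ} {flip τ′}
  (∘ₚ-cancelˡ σ (flip τ) (flip τ′) (arcCode-determines {π = relocate σ τ} {relocate σ τ′}
    (¬LD⇒noncrossing σ τ ¬ld) (¬LD⇒noncrossing τ σ (¬ld ∘ LD-sym τ σ))
    (¬LD⇒noncrossing σ τ′ ¬ld′) (¬LD⇒noncrossing τ′ σ (¬ld′ ∘ LD-sym τ′ σ))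
    (funToFin-injective _ _ same)))

lower-bound : {S : List (Permutation′ n)} → PairwiseLD S →
              (∀ S′ → PairwiseLD S′ → length S′ ≤ length S) → n ! ≤ length S * 5 ^ n
lower-bound {n} {S} ld maximal = injective⇒≤ {f = code ∘ unrank} λ {x} {y} eq →
  unrank-injective x y (code-injective (unrank x) (unrank y) eq)
  where
  blocker : (τ : Permutation′ n) → Any (λ σ → ¬ LocallyDisjoint σ τ) S
  blocker τ with Any.any? (λ σ → ¬? (LD? σ τ)) S
  ... | yes blocked = blocked
  ... | no ¬blocked =
    ⊥-elim (1+n≰n (maximal (τ ∷ S) (All.map (λ {σ} → ld-with-τ σ) (¬Any⇒All¬ S ¬blocked) ∷ ld)))
    where
    ld-with-τ : ∀ σ → ¬ ¬ LocallyDisjoint σ τ → LocallyDisjoint τ σ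
    ld-with-τ σ ¬¬ld = LD-sym σ τ (decidable-stable (LD? σ τ) ¬¬ld)
  code : Permutation′ n → Fin (length S * 5 ^ n)
  code τ = combine (index (blocker τ)) (funToFin (arcCode (relocate (Any.lookup (blocker τ)) τ)))
  code-injective : ∀ τ τ′ → code τ ≡ code τ′ → τ ≈ τ′
  code-injective τ τ′ eq = ¬LD-determined σ τ τ′ (lookup-result (blocker τ))
    (subst (λ ρ → ¬ LocallyDisjoint ρ τ′) (sym σ≡σ′) (lookup-result (blocker τ′)))
    (trans (proj₂ same) (cong (λ ρ → funToFin (arcCode (relocate ρ τ′))) (sym σ≡σ′)))
    where
    σ : Permutation′ n
    σ = Any.lookup (blocker τ)
    same : index (blocker τ) ≡ index (blocker τ′) ×
           funToFin (arcCode (relocate σ τ)) ≡ funToFin (arcCode (relocate (Any.lookup (blocker τ′)) τ′))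
    same = combine-injective (index (blocker τ)) _ (index (blocker τ′)) _ eq
    σ≡σ′ : σ ≡ Any.lookup (blocker τ′)
    σ≡σ′ = cong (lookup S) (proj₁ same)

-- Existence of the maximum

any-list? : ∀ {N} k (P : List (Fin N) → Set) → (∀ l → Dec (P l)) → Dec (∃ λ l → length l ≡ k × P l)
any-list? zero P P? with P? []
... | yes p = yes ([] , refl , p)
... | no ¬p = no λ { ([] , _ , p) → ¬p p ; (_ ∷ _ , () , _) }
any-list? (suc k) P P? with any? (λ x → any-list? k (P ∘ (x ∷_)) (P? ∘ (x ∷_)))
... | yes (x , l , len , p) = yes (x ∷ l , cong suc len , p)
... | no ¬p = no λ { ([] , () , _) ; (x ∷ l , len , p) → ¬p (x , l , ℕ.suc-injective len , p) }

bounded-maximum : (Q : ℕ → Set) → (∀ k → Dec (Q k)) → Q 0 → ∀ B → (∀ k → Q k → k ≤ B) →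
                  ∃ λ m → Q m × (∀ k → Q k → k ≤ m)
bounded-maximum Q Q? q₀ zero    bounded = 0 , q₀ , bounded
bounded-maximum Q Q? q₀ (suc B) bounded with Q? (suc B)
... | yes q = suc B , q , bounded
... | no ¬q = bounded-maximum Q Q? q₀ B λ k q →
  ℕ.≤-pred (ℕ.≤∧≢⇒< (bounded k q) λ k≡1+B → ¬q (subst Q k≡1+B q))

PairwiseLDOfLength : ℕ → ℕ → Set
PairwiseLDOfLength n k = Σ (List (Permutation′ n)) λ S → PairwiseLD S × length S ≡ k

pairwiseLDOfLength? : ∀ n k → Dec (PairwiseLDOfLength n k)
pairwiseLDOfLength? n k = Dec.map′ fromRanks toRanks
  (any-list? k (PairwiseLD ∘ map (unrank {n})) (allPairs? LD? ∘ map (unrank {n})))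
  where
  fromRanks : (∃ λ l → length l ≡ k × PairwiseLD (map (unrank {n}) l)) → PairwiseLDOfLength n k
  fromRanks (l , len , ld) = map (unrank {n}) l , ld , trans (length-map (unrank {n}) l) len
  toRanks : PairwiseLDOfLength n k → ∃ λ l → length l ≡ k × PairwiseLD (map (unrank {n}) l)
  toRanks (S , ld , len) = map rank S , trans (length-map rank S) len ,
    map⁺ (map⁺ (AllPairs.map (λ {σ} {τ} → LD-resp-≈ {σ = σ} {unrank (rank σ)} {τ} {unrank (rank τ)}
                                              (sym ∘ unrank-rank σ) (sym ∘ unrank-rank τ)) ld))

pairwiseLDOfLength⇒≤n! : ∀ {k} → PairwiseLDOfLength n k → k ≤ n !
pairwiseLDOfLength⇒≤n! {n} (S , ld , refl) =
  ℕ.≤-trans (m≤m*n (length S) (6 ^ blocks n) {{m^n≢0 6 (blocks n)}}) (upper-bound ld)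

∃-IsM : ∀ n → ∃ (IsM n)
∃-IsM n with bounded-maximum (PairwiseLDOfLength n) (pairwiseLDOfLength? n) ([] , [] , refl) (n !)
                             (λ _ → pairwiseLDOfLength⇒≤n!)
... | m , found , maximal = m , found , λ S ld → maximal (length S) (S , ld , refl)

theorem1 : ∀ (n : ℕ) → 1 ≤ n →
    Σ ℕ λ m → IsM n m × (n ! ≤ m * 5 ^ n) × (m * 6 ^ (n / 3) ≤ n !)
theorem1 n _ with ∃-IsM n
... | _ , isM@((S , ld , refl) , maximal) =
  length S , isM , lower-bound ld maximal ,
  subst (λ b → length S * 6 ^ b ≤ n !) (blocks≡n/3 n) (upper-bound ld)
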